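{- Let $P=(p_1,p_2,p_3,p_4)$ be in general position in the plane, $f\in\mathbb{R}^{\binom42}$, and $R:=\sum_{1\le i<j\le4}w_{ij}f_{ij}$ with $w_{ij}=1/(\det(p_i,p_j,p_k)\det(p_i,p_j,p_l))$, $\{k,l\}$ the complementary indices. For every pair $kl$, the following are equivalent: (1) the graph $G_{kl}$ (the complete graph on $P$ minus the edge $kl$) appears as a vertex of $\bar X_f(P)$, i.e. there is a vertex $v$ of $\bar X_f(P)$ with $E(v)=G_{kl}$; (2) $R$ and $w_{kl}$ have opposite signs.
   Context: $\det(q_0,q_1,q_2)$ is the determinant with columns $(q_0,1),(q_1,1),(q_2,1)$. Motions $v\in(\mathbb{R}^2)^4$, normalized by $v_q=0$ and first coordinate of $v_{q'}=0$ for two fixed points $q,q'\in P$ with distinct second coordinates. $\bar X_f(P)$ is the set of normalized $v$ with $\langle p_i-p_j,v_i-v_j\rangle\ge f_{ij}$ for all $i<j$; $E(v)$ is the set of pairs whose inequality holds with equality at $v$. -}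

module Defs where

open import Level using (0ℓ)
open import Data.Fin using (Fin; zero; suc) renaming (_<_ to _<ᶠ_)
open import Data.Product using (_×_; _,_; proj₁; proj₂; Σ; ∃)
open import Data.Sum using (_⊎_)
open import Data.List using (List; []; _∷_; foldr)
open import Relation.Binary.PropositionalEquality using (_≡_; _≢_)
open import Relation.Binary.Structures using (IsStrictTotalOrder)
open import Relation.Nullary using (¬_)
open import Function.Bundles using (_⇔_)
import Algebra.Structures as AS

-- The real numbers, given axiomatically as a complete ordered field
-- (with the total-inverse convention 0⁻¹ = 0).  Any model is isomorphic to ℝ.
record RealField : Set₁ where
  infixl 6 _+_ _-_
  infixl 7 _*_
  infix 4 _<_ _≤_
  field
    ℝ : Set
    _+_ _*_ : ℝ → ℝ → ℝ
    -_ : ℝ → ℝ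
    _⁻¹ : ℝ → ℝ
    0ℝ 1ℝ : ℝ
    _<_ : ℝ → ℝ → Set
    isCommutativeRing : AS.IsCommutativeRing {A = ℝ} _≡_ _+_ _*_ -_ 0ℝ 1ℝ
    0≢1 : 0ℝ ≢ 1ℝ
    *-inverse : ∀ x → x ≢ 0ℝ → x * (x ⁻¹) ≡ 1ℝ
    inv-zero : 0ℝ ⁻¹ ≡ 0ℝ
    isStrictTotalOrder : IsStrictTotalOrder _≡_ _<_
    +-mono-< : ∀ {a b} c → a < b → a + c < b + c
    *-pos : ∀ {a b} → 0ℝ < a → 0ℝ < b → 0ℝ < a * b
  _-_ : ℝ → ℝ → ℝ
  a - b = a + (- b)
  _≤_ : ℝ → ℝ → Set
  a ≤ b = (a < b) ⊎ (a ≡ b)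
  field
    complete : (S : ℝ → Set) → ∃ S → ∃ (λ b → ∀ x → S x → x ≤ b) →
               ∃ (λ s → (∀ x → S x → x ≤ s) × (∀ b → (∀ x → S x → x ≤ b) → s ≤ b))

module Geometry (F : RealField) where
  open RealField F public

  Point : Set
  Point = ℝ × ℝ

  Config : Set
  Config = Fin 4 → Point

  Motion : Set
  Motion = Fin 4 → Point

  -- det of the 3×3 matrix with columns (q₀,1), (q₁,1), (q₂,1)
  det : Point → Point → Point → ℝ
  det (a₁ , a₂) (b₁ , b₂) (c₁ , c₂) =
    a₁ * (b₂ - c₂) - b₁ * (a₂ - c₂) + c₁ * (a₂ - b₂)

  GeneralPosition : Config → Set
  GeneralPosition p = ∀ i j k → i ≢ j → j ≢ k → i ≢ k → det (p i) (p j) (p k) ≢ 0ℝ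

  _⊖_ : Point → Point → Point
  (a₁ , a₂) ⊖ (b₁ , b₂) = (a₁ - b₁ , a₂ - b₂)

  ⟨_,_⟩ : Point → Point → ℝ
  ⟨ (a₁ , a₂) , (b₁ , b₂) ⟩ = a₁ * b₁ + a₂ * b₂

  -- f ∈ ℝ^(4 choose 2): only the values f i j with i < j are used
  EdgeFn : Set
  EdgeFn = Fin 4 → Fin 4 → ℝ

  -- the complementary indices {k,l} of a pair i < j (irrelevant otherwise)
  complement : Fin 4 → Fin 4 → Fin 4 × Fin 4
  complement zero (suc zero) = (suc (suc zero) , suc (suc (suc zero)))
  complement zero (suc (suc zero)) = (suc zero , suc (suc (suc zero)))
  complement zero (suc (suc (suc zero))) = (suc zero , suc (suc zero))
  complement (suc zero) (suc (suc zero)) = (zero , suc (suc (suc zero)))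
  complement (suc zero) (suc (suc (suc zero))) = (zero , suc (suc zero))
  complement (suc (suc zero)) (suc (suc (suc zero))) = (zero , suc zero)
  complement _ _ = (zero , zero)

  w : Config → Fin 4 → Fin 4 → ℝ
  w p i j = (det (p i) (p j) (p (proj₁ (complement i j))) *
             det (p i) (p j) (p (proj₂ (complement i j)))) ⁻¹

  pairs : List (Fin 4 × Fin 4)
  pairs = (zero , suc zero) ∷ (zero , suc (suc zero)) ∷ (zero , suc (suc (suc zero)))
        ∷ (suc zero , suc (suc zero)) ∷ (suc zero , suc (suc (suc zero)))
        ∷ (suc (suc zero) , suc (suc (suc zero))) ∷ []

  R : Config → EdgeFn → ℝ
  R p f = foldr (λ ij acc → w p (proj₁ ij) (proj₂ ij) * f (proj₁ ij) (proj₂ ij) + acc) 0ℝ pairs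

  Normalized : Fin 4 → Fin 4 → Motion → Set
  Normalized q q' v = (v q ≡ (0ℝ , 0ℝ)) × (proj₁ (v q') ≡ 0ℝ)

  InX : Config → EdgeFn → Fin 4 → Fin 4 → Motion → Set
  InX p f q q' v = Normalized q q' v ×
    (∀ i j → i <ᶠ j → f i j ≤ ⟨ p i ⊖ p j , v i ⊖ v j ⟩)

  Tight : Config → EdgeFn → Motion → Fin 4 → Fin 4 → Set
  Tight p f v i j = ⟨ p i ⊖ p j , v i ⊖ v j ⟩ ≡ f i j

  _·_ : ℝ → Point → Point
  t · (a₁ , a₂) = (t * a₁ , t * a₂)

  _⊕_ : Point → Point → Point
  (a₁ , a₂) ⊕ (b₁ , b₂) = (a₁ + b₁ , a₂ + b₂)

  IsVertex : Config → EdgeFn → Fin 4 → Fin 4 → Motion → Set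
  IsVertex p f q q' v = InX p f q q' v ×
    (∀ a b t → InX p f q q' a → InX p f q q' b → 0ℝ < t → t < 1ℝ →
       (∀ i → v i ≡ (t · a i) ⊕ ((1ℝ - t) · b i)) → ∀ i → a i ≡ b i)

-- The coefficients ω i = ± det of the other three points form the affine dependence of P
-- (Σ ω i = 0 and Σ ω i p i = 0), and w i j = ω i ω j / s for a nonzero constant s. Hence w is a
-- self-stress of K₄ on P: Σ w i j ⟨p i − p j , v i − v j⟩ = 0 for every motion v, i.e. R vanishes
-- on the image of the rigidity map. If v is tight on every edge but kl, subtracting gives
-- R = w kl (f kl − ⟨p k − p l , v k − v l⟩), so R w kl < 0 exactly when kl is slack at v.
-- Motions tight on the five edges of K₄ − kl exist (two Henneberg steps from an edge), and K₄ is
-- infinitesimally rigid, so a normalized motion is determined by its edge values. If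
-- v = t a + (1 − t) b inside X̄_f(P), then a and b are tight wherever v is, the stress forces them
-- to agree on kl as well, and so a = b: v is a vertex.

{-# OPTIONS --safe #-}
module Submission where

open import Defs
open import Level using (0ℓ)
open import Algebra.Bundles using (CommutativeRing)
open import Data.Empty using (⊥-elim)
open import Data.Fin using (Fin; suc; #_) renaming (_<_ to _<ᶠ_)
import Data.Fin.Properties as Fin
open import Data.Fin.Patterns using (0F; 1F; 2F; 3F)
open import Data.Integer.Base as ℤ using (ℤ; -[1+_]; 0ℤ; 1ℤ)
import Data.Integer.Properties as ℤ
open import Data.List.Base using (List; []; _∷_; foldr; allFin)
open import Data.List.Membership.Propositional using (_∈_)
import Data.List.Relation.Unary.All as All
open import Data.List.Relation.Unary.AllPairs using (_∷_)
open import Data.List.Relation.Unary.Any using (here; there)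
open import Data.List.Relation.Unary.Unique.DecPropositional using (unique?)
open import Data.List.Relation.Unary.Unique.Propositional using (Unique)
open import Data.Maybe.Base using (Maybe; map)
open import Data.Nat.Base as ℕ using (suc)
import Data.Nat.Properties as ℕ
open import Data.Product using (_×_; _,_; proj₁; proj₂; Σ; ∃)
open import Data.Product.Properties using (≡-dec)
import Data.Sign.Base as Sign
open import Data.Sum using (inj₁; inj₂)
open import Data.Vec.Base using (Vec) renaming (_∷_ to _∷ᵥ_; [] to []ᵥ)
open import Function.Bundles using (_⇔_; mk⇔; Equivalence)
open import Function.Properties.Equivalence using () renaming (trans to ⇔-trans)
open import Relation.Binary.Consequences using (dec⇒weaklyDec)
open import Relation.Binary.Definitions using (tri<; tri≈; tri>)
open import Relation.Binary.PropositionalEquality using (_≡_; _≢_)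
import Relation.Binary.PropositionalEquality as ≡
open import Relation.Binary.Structures using (IsStrictTotalOrder)
open import Relation.Nullary using (¬_)
open import Relation.Nullary.Decidable using (yes; no; _×-dec_; from-yes)

-- The standard library instantiates this solver only with natural-number coefficients, whose
-- negation is the identity; identities with subtraction need integer coefficients.
module IntegerCoefficientRingSolver {c ℓ} (R : CommutativeRing c ℓ) where
  open CommutativeRing R
  open import Algebra.Properties.Ring ring
    using (-‿distribˡ-*; -‿distribʳ-*; -‿involutive; -0#≈0#; -‿+-comm)
  open import Algebra.Properties.Semiring.Mult.TCOptimised semiring
    using (×-homo-+; ×1-homo-*; 1+×) renaming (_×_ to _×ℕ_)
  open import Algebra.Solver.Ring.AlmostCommutativeRing
    using (fromCommutativeRing; _-Raw-AlmostCommutative⟶_)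
  open import Relation.Binary.Reasoning.Setoid setoid

  ⟦_⟧ : ℤ → Carrier
  ⟦ ℤ.+ n ⟧ = n ×ℕ 1#
  ⟦ -[1+ n ] ⟧ = - (suc n ×ℕ 1#)

  private
    x-0≈x : ∀ x → x - 0# ≈ x
    x-0≈x x = trans (+-congˡ -0#≈0#) (+-identityʳ x)

    [z+x]-[z+y]≈x-y : ∀ x y z → (z + x) - (z + y) ≈ x - y
    [z+x]-[z+y]≈x-y x y z = begin
      (z + x) - (z + y)     ≈⟨ +-congˡ (-‿+-comm z y) ⟨
      (z + x) + (- z - y)   ≈⟨ +-assoc z x (- z - y) ⟩
      z + (x + (- z - y))   ≈⟨ +-congˡ (+-congˡ (+-comm (- z) (- y))) ⟩
      z + (x + (- y - z))   ≈⟨ +-congˡ (+-assoc x (- y) (- z)) ⟨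
      z + ((x - y) - z)     ≈⟨ +-comm z _ ⟩
      ((x - y) - z) + z     ≈⟨ +-assoc (x - y) (- z) z ⟩
      (x - y) + (- z + z)   ≈⟨ +-congˡ (-‿inverseˡ z) ⟩
      (x - y) + 0#          ≈⟨ +-identityʳ (x - y) ⟩
      x - y                 ∎

    -x*-y≈x*y : ∀ x y → - x * - y ≈ x * y
    -x*-y≈x*y x y = begin
      - x * - y     ≈⟨ -‿distribˡ-* x (- y) ⟨
      - (x * - y)   ≈⟨ -‿cong (-‿distribʳ-* x y) ⟨
      - - (x * y)   ≈⟨ -‿involutive (x * y) ⟩
      x * y         ∎

  ⟦⊖⟧ : ∀ m n → ⟦ m ℤ.⊖ n ⟧ ≈ m ×ℕ 1# - n ×ℕ 1#
  ⟦⊖⟧ 0 0 = sym (-‿inverseʳ 0#)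
  ⟦⊖⟧ 0 (suc n) = sym (+-identityˡ _)
  ⟦⊖⟧ (suc m) 0 = sym (x-0≈x _)
  ⟦⊖⟧ (suc m) (suc n) = begin
    ⟦ suc m ℤ.⊖ suc n ⟧   ≡⟨ ≡.cong ⟦_⟧ (ℤ.[1+m]⊖[1+n]≡m⊖n m n) ⟩
    ⟦ m ℤ.⊖ n ⟧           ≈⟨ ⟦⊖⟧ m n ⟩
    m ×ℕ 1# - n ×ℕ 1#     ≈⟨ [z+x]-[z+y]≈x-y _ _ 1# ⟨
    (1# + m ×ℕ 1#) - (1# + n ×ℕ 1#) ≈⟨ +-cong (1+× m 1#) (-‿cong (1+× n 1#)) ⟨
    suc m ×ℕ 1# - suc n ×ℕ 1# ∎

  ⟦⟧-homo-+ : ∀ i j → ⟦ i ℤ.+ j ⟧ ≈ ⟦ i ⟧ + ⟦ j ⟧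
  ⟦⟧-homo-+ (ℤ.+ m) (ℤ.+ n) = ×-homo-+ 1# m n
  ⟦⟧-homo-+ (ℤ.+ m) -[1+ n ] = ⟦⊖⟧ m (suc n)
  ⟦⟧-homo-+ -[1+ m ] (ℤ.+ n) = trans (⟦⊖⟧ n (suc m)) (+-comm _ _)
  ⟦⟧-homo-+ -[1+ m ] -[1+ n ] = begin
    - (suc (suc (m ℕ.+ n)) ×ℕ 1#)        ≡⟨ ≡.cong (λ k → - (suc k ×ℕ 1#)) (ℕ.+-suc m n) ⟨
    - ((suc m ℕ.+ suc n) ×ℕ 1#)          ≈⟨ -‿cong (×-homo-+ 1# (suc m) (suc n)) ⟩
    - (suc m ×ℕ 1# + suc n ×ℕ 1#)         ≈⟨ -‿+-comm _ _ ⟨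
    - (suc m ×ℕ 1#) + - (suc n ×ℕ 1#)     ∎

  ⟦⟧-homo-‿ : ∀ i → ⟦ ℤ.- i ⟧ ≈ - ⟦ i ⟧
  ⟦⟧-homo-‿ (ℤ.+ 0) = sym -0#≈0#
  ⟦⟧-homo-‿ (ℤ.+ suc n) = refl
  ⟦⟧-homo-‿ -[1+ n ] = sym (-‿involutive _)

  ⟦⟧-homo-* : ∀ i j → ⟦ i ℤ.* j ⟧ ≈ ⟦ i ⟧ * ⟦ j ⟧
  ⟦⟧-homo-* (ℤ.+ m) (ℤ.+ n) = begin
    ⟦ Sign.+ ℤ.◃ (m ℕ.* n) ⟧ ≡⟨ ≡.cong ⟦_⟧ (ℤ.+◃n≡+n (m ℕ.* n)) ⟩
    ⟦ ℤ.+ (m ℕ.* n) ⟧ ≈⟨ ×1-homo-* m n ⟩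
    ⟦ ℤ.+ m ⟧ * ⟦ ℤ.+ n ⟧ ∎
  ⟦⟧-homo-* (ℤ.+ m) -[1+ n ] = begin
    ⟦ Sign.- ℤ.◃ (m ℕ.* suc n) ⟧ ≡⟨ ≡.cong ⟦_⟧ (ℤ.-◃n≡-n (m ℕ.* suc n)) ⟩
    ⟦ ℤ.- ℤ.+ (m ℕ.* suc n) ⟧ ≈⟨ ⟦⟧-homo-‿ (ℤ.+ (m ℕ.* suc n)) ⟩
    - ⟦ ℤ.+ (m ℕ.* suc n) ⟧ ≈⟨ -‿cong (×1-homo-* m (suc n)) ⟩
    - (⟦ ℤ.+ m ⟧ * ⟦ ℤ.+ suc n ⟧) ≈⟨ -‿distribʳ-* _ _ ⟩
    ⟦ ℤ.+ m ⟧ * ⟦ -[1+ n ] ⟧ ∎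
  ⟦⟧-homo-* -[1+ m ] (ℤ.+ n) = begin
    ⟦ Sign.- ℤ.◃ (suc m ℕ.* n) ⟧ ≡⟨ ≡.cong ⟦_⟧ (ℤ.-◃n≡-n (suc m ℕ.* n)) ⟩
    ⟦ ℤ.- ℤ.+ (suc m ℕ.* n) ⟧ ≈⟨ ⟦⟧-homo-‿ (ℤ.+ (suc m ℕ.* n)) ⟩
    - ⟦ ℤ.+ (suc m ℕ.* n) ⟧ ≈⟨ -‿cong (×1-homo-* (suc m) n) ⟩
    - (⟦ ℤ.+ suc m ⟧ * ⟦ ℤ.+ n ⟧) ≈⟨ -‿distribˡ-* _ _ ⟩
    ⟦ -[1+ m ] ⟧ * ⟦ ℤ.+ n ⟧ ∎
  ⟦⟧-homo-* -[1+ m ] -[1+ n ] = begin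
    ⟦ Sign.+ ℤ.◃ (suc m ℕ.* suc n) ⟧ ≡⟨ ≡.cong ⟦_⟧ (ℤ.+◃n≡+n (suc m ℕ.* suc n)) ⟩
    ⟦ ℤ.+ (suc m ℕ.* suc n) ⟧ ≈⟨ ×1-homo-* (suc m) (suc n) ⟩
    ⟦ ℤ.+ suc m ⟧ * ⟦ ℤ.+ suc n ⟧ ≈⟨ -x*-y≈x*y _ _ ⟨
    ⟦ -[1+ m ] ⟧ * ⟦ -[1+ n ] ⟧ ∎

  homomorphism : ℤ.+-*-rawRing -Raw-AlmostCommutative⟶ fromCommutativeRing R
  homomorphism = record
    { ⟦_⟧ = ⟦_⟧
    ; +-homo = ⟦⟧-homo-+
    ; *-homo = ⟦⟧-homo-*
    ; -‿homo = ⟦⟧-homo-‿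
    ; 0-homo = refl
    ; 1-homo = refl
    }

  private
    ⟦⟧-≟ : ∀ i j → Maybe (⟦ i ⟧ ≈ ⟦ j ⟧)
    ⟦⟧-≟ i j = map (λ { ≡.refl → refl }) (dec⇒weaklyDec ℤ._≟_ i j)

  open import Algebra.Solver.Ring ℤ.+-*-rawRing (fromCommutativeRing R) homomorphism ⟦⟧-≟
    public using (solve; prove; _:=_; Polynomial; con; var; _:+_; _:*_; _:-_; :-_)

module RealFieldProperties (F : RealField) where
  open RealField F
  open IsStrictTotalOrder isStrictTotalOrder
    using (compare; irrefl; <-respˡ-≈; <-respʳ-≈) renaming (trans to <-trans)

  commutativeRing : CommutativeRing 0ℓ 0ℓ
  commutativeRing = record { isCommutativeRing = isCommutativeRing }

  open CommutativeRing commutativeRing public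
    using (+-comm; +-identityˡ; +-identityʳ; -‿inverseʳ; *-assoc; *-identityʳ; zeroˡ; zeroʳ)
  open IntegerCoefficientRingSolver commutativeRing public

  open ≡ using (refl; sym; trans; cong; cong₂)
  open ≡.≡-Reasoning

  x-y≡0⇒x≡y : ∀ {x y} → x - y ≡ 0ℝ → x ≡ y
  x-y≡0⇒x≡y {x} {y} x-y≡0 = begin
    x             ≡⟨ solve 2 (λ x y → x := (x :- y) :+ y) refl x y ⟩
    (x - y) + y   ≡⟨ cong (_+ y) x-y≡0 ⟩
    0ℝ + y        ≡⟨ +-identityˡ y ⟩
    y             ∎

  x≡y⇒x-y≡0 : ∀ {x y} → x ≡ y → x - y ≡ 0ℝ
  x≡y⇒x-y≡0 {x} refl = -‿inverseʳ x

  x*y≡0⇒y≡0 : ∀ {x y} → x ≢ 0ℝ → x * y ≡ 0ℝ → y ≡ 0ℝ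
  x*y≡0⇒y≡0 {x} {y} x≢0 xy≡0 = begin
    y                   ≡⟨ solve 1 (λ y → y := con 1ℤ :* y) refl y ⟩
    1ℝ * y              ≡⟨ cong (_* y) (*-inverse x x≢0) ⟨
    (x * x ⁻¹) * y      ≡⟨ solve 3 (λ x x⁻¹ y → (x :* x⁻¹) :* y := x⁻¹ :* (x :* y)) refl x (x ⁻¹) y ⟩
    x ⁻¹ * (x * y)      ≡⟨ cong (x ⁻¹ *_) xy≡0 ⟩
    x ⁻¹ * 0ℝ           ≡⟨ zeroʳ (x ⁻¹) ⟩
    0ℝ                  ∎

  *-cancelˡ : ∀ {x y z} → x ≢ 0ℝ → x * y ≡ x * z → y ≡ z
  *-cancelˡ {x} {y} {z} x≢0 xy≡xz = x-y≡0⇒x≡y (x*y≡0⇒y≡0 x≢0 (begin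
    x * (y - z)     ≡⟨ solve 3 (λ x y z → x :* (y :- z) := x :* y :- x :* z) refl x y z ⟩
    x * y - x * z   ≡⟨ x≡y⇒x-y≡0 xy≡xz ⟩
    0ℝ              ∎))

  x*y≢0 : ∀ {x y} → x ≢ 0ℝ → y ≢ 0ℝ → x * y ≢ 0ℝ
  x*y≢0 x≢0 y≢0 xy≡0 = y≢0 (x*y≡0⇒y≡0 x≢0 xy≡0)

  -x≢0 : ∀ {x} → x ≢ 0ℝ → - x ≢ 0ℝ
  -x≢0 {x} x≢0 -x≡0 = x≢0 (begin
    x       ≡⟨ solve 1 (λ x → x := :- (:- x)) refl x ⟩
    - - x   ≡⟨ cong -_ -x≡0 ⟩
    - 0ℝ    ≡⟨ solve 0 (:- con 0ℤ := con 0ℤ) refl ⟩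
    0ℝ      ∎)

  x≡d*m⇒x*d⁻¹≡m : ∀ {x d m} → x ≢ 0ℝ → x ≡ d * m → x * d ⁻¹ ≡ m
  x≡d*m⇒x*d⁻¹≡m {d = d} {m} x≢0 refl = begin
    (d * m) * d ⁻¹   ≡⟨ solve 3 (λ d m d⁻¹ → (d :* m) :* d⁻¹ := (d :* d⁻¹) :* m) refl d m (d ⁻¹) ⟩
    (d * d ⁻¹) * m   ≡⟨ cong (_* m) (*-inverse d d≢0) ⟩
    1ℝ * m           ≡⟨ solve 1 (λ m → con 1ℤ :* m := m) refl m ⟩
    m                ∎
    where
    d≢0 : d ≢ 0ℝ
    d≢0 refl = x≢0 (zeroˡ m)

  <-irrefl : ∀ {x} → ¬ (x < x)
  <-irrefl = irrefl refl

  ≤∧≢⇒< : ∀ {x y} → x ≤ y → x ≢ y → x < y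
  ≤∧≢⇒< (inj₁ x<y) _ = x<y
  ≤∧≢⇒< (inj₂ x≡y) x≢y = ⊥-elim (x≢y x≡y)

  x<y⇒0<y-x : ∀ {x y} → x < y → 0ℝ < y - x
  x<y⇒0<y-x {x} x<y = <-respˡ-≈ (-‿inverseʳ x) (+-mono-< (- x) x<y)

  0<y-x⇒x<y : ∀ {x y} → 0ℝ < y - x → x < y
  0<y-x⇒x<y {x} {y} 0<y-x =
    <-respʳ-≈ (solve 2 (λ x y → (y :- x) :+ x := y) refl x y) (<-respˡ-≈ (+-identityˡ x) (+-mono-< x 0<y-x))

  x-y<0⇔x<y : ∀ {x y} → x - y < 0ℝ ⇔ x < y
  x-y<0⇔x<y {x} {y} = mk⇔
    (λ x-y<0 → <-respʳ-≈ (+-identityˡ y) (<-respˡ-≈ (solve 2 (λ x y → (x :- y) :+ y := x) refl x y) (+-mono-< y x-y<0)))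
    (λ x<y → <-respʳ-≈ (-‿inverseʳ y) (+-mono-< (- y) x<y))

  x<0⇒0<-x : ∀ {x} → x < 0ℝ → 0ℝ < - x
  x<0⇒0<-x {x} x<0 = <-respʳ-≈ (+-identityˡ (- x)) (<-respˡ-≈ (-‿inverseʳ x) (+-mono-< (- x) x<0))

  0<-x⇒x<0 : ∀ {x} → 0ℝ < - x → x < 0ℝ
  0<-x⇒x<0 {x} 0<-x =
    <-respʳ-≈ (solve 1 (λ x → :- x :+ x := con 0ℤ) refl x) (<-respˡ-≈ (+-identityˡ x) (+-mono-< x 0<-x))

  0<x*x : ∀ {x} → x ≢ 0ℝ → 0ℝ < x * x
  0<x*x {x} x≢0 with compare x 0ℝ
  ... | tri< x<0 _ _ = <-respʳ-≈ (solve 1 (λ x → :- x :* :- x := x :* x) refl x) (*-pos (x<0⇒0<-x x<0) (x<0⇒0<-x x<0))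
  ... | tri≈ _ x≡0 _ = ⊥-elim (x≢0 x≡0)
  ... | tri> _ _ 0<x = *-pos 0<x 0<x

  0<a⇒[a*y<0⇔y<0] : ∀ {a y} → 0ℝ < a → a * y < 0ℝ ⇔ y < 0ℝ
  0<a⇒[a*y<0⇔y<0] {a} {y} 0<a = mk⇔ to from
    where
    to : a * y < 0ℝ → y < 0ℝ
    to ay<0 with compare y 0ℝ
    ... | tri< y<0 _ _ = y<0
    ... | tri≈ _ refl _ = ⊥-elim (<-irrefl (<-respˡ-≈ (zeroʳ a) ay<0))
    ... | tri> _ _ 0<y = ⊥-elim (<-irrefl (<-trans (*-pos 0<a 0<y) ay<0))
    from : y < 0ℝ → a * y < 0ℝ
    from y<0 = 0<-x⇒x<0 (<-respʳ-≈ (solve 2 (λ a y → a :* :- y := :- (a :* y)) refl a y) (*-pos 0<a (x<0⇒0<-x y<0)))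

  x*y*x<0⇔y<0 : ∀ {x y} → x ≢ 0ℝ → (x * y) * x < 0ℝ ⇔ y < 0ℝ
  x*y*x<0⇔y<0 {x} {y} x≢0 = mk⇔
    (λ xyx<0 → Equivalence.to (0<a⇒[a*y<0⇔y<0] (0<x*x x≢0)) (<-respˡ-≈ reorder xyx<0))
    (λ y<0 → <-respˡ-≈ (sym reorder) (Equivalence.from (0<a⇒[a*y<0⇔y<0] (0<x*x x≢0)) y<0))
    where
    reorder : (x * y) * x ≡ (x * x) * y
    reorder = solve 2 (λ x y → (x :* y) :* x := (x :* x) :* y) refl x y

  *-monoˡ-< : ∀ {t x y} → 0ℝ < t → x < y → t * x < t * y
  *-monoˡ-< {t} {x} {y} 0<t x<y = 0<y-x⇒x<y
    (<-respʳ-≈ (solve 3 (λ t x y → t :* (y :- x) := t :* y :- t :* x) refl t x y) (*-pos 0<t (x<y⇒0<y-x x<y)))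

  *-monoˡ-≤ : ∀ {t x y} → 0ℝ < t → x ≤ y → t * x ≤ t * y
  *-monoˡ-≤ 0<t (inj₁ x<y) = inj₁ (*-monoˡ-< 0<t x<y)
  *-monoˡ-≤ 0<t (inj₂ refl) = inj₂ refl

  +-mono-<-≤ : ∀ {a b c d} → a < b → c ≤ d → a + c < b + d
  +-mono-<-≤ {c = c} a<b (inj₂ refl) = +-mono-< c a<b
  +-mono-<-≤ {b = b} {c} {d} a<b (inj₁ c<d) =
    <-trans (+-mono-< c a<b) (<-respˡ-≈ (+-comm c b) (<-respʳ-≈ (+-comm d b) (+-mono-< b c<d)))

  proper-convex-combination-of-≥⇒≡ : ∀ {t c a b} → 0ℝ < t → t < 1ℝ → c ≤ a → c ≤ b →
    c ≡ t * a + (1ℝ - t) * b → a ≡ c × b ≡ c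
  proper-convex-combination-of-≥⇒≡ {t} {c} {a} {b} 0<t t<1 c≤a c≤b c≡ta+sb = tight-a c≤a , tight-b c≤b
    where
    0<s : 0ℝ < 1ℝ - t
    0<s = x<y⇒0<y-x t<1
    c≡tc+sc : c ≡ t * c + (1ℝ - t) * c
    c≡tc+sc = solve 2 (λ t c → c := t :* c :+ (con 1ℤ :- t) :* c) refl t c
    tight-a : c ≤ a → a ≡ c
    tight-a (inj₂ c≡a) = sym c≡a
    tight-a (inj₁ c<a) = ⊥-elim (<-irrefl (<-respˡ-≈ (sym c≡tc+sc) (<-respʳ-≈ (sym c≡ta+sb)
      (+-mono-<-≤ (*-monoˡ-< 0<t c<a) (*-monoˡ-≤ 0<s c≤b)))))
    tight-b : c ≤ b → b ≡ c
    tight-b (inj₂ c≡b) = sym c≡b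
    tight-b (inj₁ c<b) = ⊥-elim (<-irrefl (<-respˡ-≈ (trans (+-comm _ _) (sym c≡tc+sc)) (<-respʳ-≈ (trans (+-comm _ _) (sym c≡ta+sb))
      (+-mono-<-≤ (*-monoˡ-< 0<s c<b) (*-monoˡ-≤ 0<t c≤a)))))

pattern e₀₁ = here ≡.refl
pattern e₀₂ = there (here ≡.refl)
pattern e₀₃ = there (there (here ≡.refl))
pattern e₁₂ = there (there (there (here ≡.refl)))
pattern e₁₃ = there (there (there (there (here ≡.refl))))
pattern e₂₃ = there (there (there (there (there (here ≡.refl)))))

module InfinitesimalMotions (F : RealField) where
  open Geometry F
  open RealFieldProperties F
  open ≡ using (refl; sym; trans; cong; cong₂; subst; ≢-sym)
  open ≡.≡-Reasoning

  O : Point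
  O = (0ℝ , 0ℝ)

  cross : Point → Point → ℝ
  cross (a₁ , a₂) (b₁ , b₂) = a₁ * b₂ - a₂ * b₁

  cross-⊖≡det : ∀ a b c → cross (a ⊖ b) (a ⊖ c) ≡ det a b c
  cross-⊖≡det (a₁ , a₂) (b₁ , b₂) (c₁ , c₂) = solve 6 (λ a₁ a₂ b₁ b₂ c₁ c₂ →
    (a₁ :- b₁) :* (a₂ :- c₂) :- (a₂ :- b₂) :* (a₁ :- c₁) := a₁ :* (b₂ :- c₂) :- b₁ :* (a₂ :- c₂) :+ c₁ :* (a₂ :- b₂))
    refl a₁ a₂ b₁ b₂ c₁ c₂

  ⟨,⊖⟩ : ∀ d u v → ⟨ d , u ⊖ v ⟩ ≡ ⟨ d , u ⟩ - ⟨ d , v ⟩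
  ⟨,⊖⟩ (d₁ , d₂) (u₁ , u₂) (v₁ , v₂) = solve 6 (λ d₁ d₂ u₁ u₂ v₁ v₂ →
    d₁ :* (u₁ :- v₁) :+ d₂ :* (u₂ :- v₂) := (d₁ :* u₁ :+ d₂ :* u₂) :- (d₁ :* v₁ :+ d₂ :* v₂)) refl d₁ d₂ u₁ u₂ v₁ v₂

  ⟨,O⟩ : ∀ d → ⟨ d , O ⟩ ≡ 0ℝ
  ⟨,O⟩ (d₁ , d₂) = solve 2 (λ d₁ d₂ → d₁ :* con 0ℤ :+ d₂ :* con 0ℤ := con 0ℤ) refl d₁ d₂

  ⊖≡O⇒≡ : ∀ {u v} → u ⊖ v ≡ O → u ≡ v
  ⊖≡O⇒≡ u⊖v≡O = cong₂ _,_ (x-y≡0⇒x≡y (cong proj₁ u⊖v≡O)) (x-y≡0⇒x≡y (cong proj₂ u⊖v≡O))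

  cramer : ∀ a b → cross a b ≢ 0ℝ → ∀ α β → Σ Point λ u → ⟨ a , u ⟩ ≡ α × ⟨ b , u ⟩ ≡ β
  cramer (a₁ , a₂) (b₁ , b₂) C≢0 α β =
    ((α * b₂ - β * a₂) * C ⁻¹ , (β * a₁ - α * b₁) * C ⁻¹) ,
    trans (solve 7 (λ a₁ a₂ b₁ b₂ α β C⁻¹ →
        a₁ :* ((α :* b₂ :- β :* a₂) :* C⁻¹) :+ a₂ :* ((β :* a₁ :- α :* b₁) :* C⁻¹) := α :* ((a₁ :* b₂ :- a₂ :* b₁) :* C⁻¹))
        refl a₁ a₂ b₁ b₂ α β (C ⁻¹)) (x*[C*C⁻¹]≡x α) ,
    trans (solve 7 (λ a₁ a₂ b₁ b₂ α β C⁻¹ →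
        b₁ :* ((α :* b₂ :- β :* a₂) :* C⁻¹) :+ b₂ :* ((β :* a₁ :- α :* b₁) :* C⁻¹) := β :* ((a₁ :* b₂ :- a₂ :* b₁) :* C⁻¹))
        refl a₁ a₂ b₁ b₂ α β (C ⁻¹)) (x*[C*C⁻¹]≡x β)
    where
    C : ℝ
    C = cross (a₁ , a₂) (b₁ , b₂)
    x*[C*C⁻¹]≡x : ∀ x → x * (C * C ⁻¹) ≡ x
    x*[C*C⁻¹]≡x x = trans (cong (x *_) (*-inverse C C≢0)) (*-identityʳ x)

  ⟨⟩≡0⇒≡O : ∀ {a b u} → cross a b ≢ 0ℝ → ⟨ a , u ⟩ ≡ 0ℝ → ⟨ b , u ⟩ ≡ 0ℝ → u ≡ O
  ⟨⟩≡0⇒≡O {a₁ , a₂} {b₁ , b₂} {u₁ , u₂} C≢0 au≡0 bu≡0 = cong₂ _,_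
    (x*y≡0⇒y≡0 C≢0 (begin
      cross (a₁ , a₂) (b₁ , b₂) * u₁
        ≡⟨ solve 6 (λ a₁ a₂ b₁ b₂ u₁ u₂ → (a₁ :* b₂ :- a₂ :* b₁) :* u₁ :=
             b₂ :* (a₁ :* u₁ :+ a₂ :* u₂) :- a₂ :* (b₁ :* u₁ :+ b₂ :* u₂)) refl a₁ a₂ b₁ b₂ u₁ u₂ ⟩
      b₂ * ⟨ (a₁ , a₂) , (u₁ , u₂) ⟩ - a₂ * ⟨ (b₁ , b₂) , (u₁ , u₂) ⟩
        ≡⟨ cong₂ (λ s t → b₂ * s - a₂ * t) au≡0 bu≡0 ⟩
      b₂ * 0ℝ - a₂ * 0ℝ
        ≡⟨ solve 2 (λ a₂ b₂ → b₂ :* con 0ℤ :- a₂ :* con 0ℤ := con 0ℤ) refl a₂ b₂ ⟩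
      0ℝ ∎))
    (x*y≡0⇒y≡0 C≢0 (begin
      cross (a₁ , a₂) (b₁ , b₂) * u₂
        ≡⟨ solve 6 (λ a₁ a₂ b₁ b₂ u₁ u₂ → (a₁ :* b₂ :- a₂ :* b₁) :* u₂ :=
             a₁ :* (b₁ :* u₁ :+ b₂ :* u₂) :- b₁ :* (a₁ :* u₁ :+ a₂ :* u₂)) refl a₁ a₂ b₁ b₂ u₁ u₂ ⟩
      a₁ * ⟨ (b₁ , b₂) , (u₁ , u₂) ⟩ - b₁ * ⟨ (a₁ , a₂) , (u₁ , u₂) ⟩
        ≡⟨ cong₂ (λ s t → a₁ * s - b₁ * t) bu≡0 au≡0 ⟩
      a₁ * 0ℝ - b₁ * 0ℝ
        ≡⟨ solve 2 (λ a₁ b₁ → a₁ :* con 0ℤ :- b₁ :* con 0ℤ := con 0ℤ) refl a₁ b₁ ⟩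
      0ℝ ∎))

  -- A Henneberg step: the two edge conditions are a linear system with determinant det c a b.
  attach : ∀ {a b c} → det c a b ≢ 0ℝ → ∀ ua ub α β →
    Σ Point λ uc → ⟨ c ⊖ a , uc ⊖ ua ⟩ ≡ α × ⟨ c ⊖ b , uc ⊖ ub ⟩ ≡ β
  attach {a} {b} {c} cab≢0 ua ub α β = uc , shift (proj₁ (proj₂ solution)) , shift (proj₂ (proj₂ solution))
    where
    solution : Σ Point λ u → ⟨ c ⊖ a , u ⟩ ≡ α + ⟨ c ⊖ a , ua ⟩ × ⟨ c ⊖ b , u ⟩ ≡ β + ⟨ c ⊖ b , ub ⟩
    solution = cramer (c ⊖ a) (c ⊖ b) (λ C≡0 → cab≢0 (trans (sym (cross-⊖≡det c a b)) C≡0))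
                 (α + ⟨ c ⊖ a , ua ⟩) (β + ⟨ c ⊖ b , ub ⟩)
    uc : Point
    uc = proj₁ solution
    shift : ∀ {d w γ} → ⟨ d , uc ⟩ ≡ γ + ⟨ d , w ⟩ → ⟨ d , uc ⊖ w ⟩ ≡ γ
    shift {d} {w} {γ} eq = begin
      ⟨ d , uc ⊖ w ⟩               ≡⟨ ⟨,⊖⟩ d uc w ⟩
      ⟨ d , uc ⟩ - ⟨ d , w ⟩       ≡⟨ cong (_- ⟨ d , w ⟩) eq ⟩
      (γ + ⟨ d , w ⟩) - ⟨ d , w ⟩  ≡⟨ solve 2 (λ γ s → (γ :+ s) :- s := γ) refl γ ⟨ d , w ⟩ ⟩
      γ                            ∎

  -- The rigidity map

  rigidityMap : Config → Motion → EdgeFn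
  rigidityMap p v i j = ⟨ p i ⊖ p j , v i ⊖ v j ⟩

  rigidityMap-sym : ∀ p v i j → rigidityMap p v i j ≡ rigidityMap p v j i
  rigidityMap-sym p v i j = solve 8 (λ a₁ a₂ b₁ b₂ u₁ u₂ v₁ v₂ →
    (a₁ :- b₁) :* (u₁ :- v₁) :+ (a₂ :- b₂) :* (u₂ :- v₂) := (b₁ :- a₁) :* (v₁ :- u₁) :+ (b₂ :- a₂) :* (v₂ :- u₂))
    refl (proj₁ (p i)) (proj₂ (p i)) (proj₁ (p j)) (proj₂ (p j)) (proj₁ (v i)) (proj₂ (v i)) (proj₁ (v j)) (proj₂ (v j))

  rigidityMap-flip : ∀ p u {i j x} → rigidityMap p u j i ≡ x → rigidityMap p u i j ≡ x
  rigidityMap-flip p u {i} {j} = trans (rigidityMap-sym p u i j)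

  rigidityMap-⊖ : ∀ p a b i j → rigidityMap p (λ x → a x ⊖ b x) i j ≡ rigidityMap p a i j - rigidityMap p b i j
  rigidityMap-⊖ p a b i j = solve 10 (λ d₁ d₂ a₁ a₂ a₁′ a₂′ b₁ b₂ b₁′ b₂′ →
    d₁ :* ((a₁ :- b₁) :- (a₁′ :- b₁′)) :+ d₂ :* ((a₂ :- b₂) :- (a₂′ :- b₂′))
      := (d₁ :* (a₁ :- a₁′) :+ d₂ :* (a₂ :- a₂′)) :- (d₁ :* (b₁ :- b₁′) :+ d₂ :* (b₂ :- b₂′)))
    refl (proj₁ (p i ⊖ p j)) (proj₂ (p i ⊖ p j)) (proj₁ (a i)) (proj₂ (a i)) (proj₁ (a j)) (proj₂ (a j))
         (proj₁ (b i)) (proj₂ (b i)) (proj₁ (b j)) (proj₂ (b j))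

  rigidityMap-convex : ∀ p {v a b} t s → (∀ x → v x ≡ (t · a x) ⊕ (s · b x)) →
    ∀ i j → rigidityMap p v i j ≡ t * rigidityMap p a i j + s * rigidityMap p b i j
  rigidityMap-convex p {v} {a} {b} t s v≡ta+sb i j = begin
    ⟨ p i ⊖ p j , v i ⊖ v j ⟩
      ≡⟨ cong₂ (λ x y → ⟨ p i ⊖ p j , x ⊖ y ⟩) (v≡ta+sb i) (v≡ta+sb j) ⟩
    ⟨ p i ⊖ p j , ((t · a i) ⊕ (s · b i)) ⊖ ((t · a j) ⊕ (s · b j)) ⟩
      ≡⟨ solve 12 (λ d₁ d₂ t s a₁ a₂ a₁′ a₂′ b₁ b₂ b₁′ b₂′ →
           d₁ :* ((t :* a₁ :+ s :* b₁) :- (t :* a₁′ :+ s :* b₁′)) :+ d₂ :* ((t :* a₂ :+ s :* b₂) :- (t :* a₂′ :+ s :* b₂′))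
             := t :* (d₁ :* (a₁ :- a₁′) :+ d₂ :* (a₂ :- a₂′)) :+ s :* (d₁ :* (b₁ :- b₁′) :+ d₂ :* (b₂ :- b₂′)))
           refl (proj₁ (p i ⊖ p j)) (proj₂ (p i ⊖ p j)) t s (proj₁ (a i)) (proj₂ (a i)) (proj₁ (a j)) (proj₂ (a j))
                (proj₁ (b i)) (proj₂ (b i)) (proj₁ (b j)) (proj₂ (b j)) ⟩
    t * rigidityMap p a i j + s * rigidityMap p b i j ∎

  perp : Point → Point
  perp (a₁ , a₂) = (- a₂ , a₁)

  rigidityMap-+-rigid : ∀ p u s c o i j →
    rigidityMap p (λ x → (u x ⊖ s) ⊕ (c · perp (p x ⊖ o))) i j ≡ rigidityMap p u i j
  rigidityMap-+-rigid p u s c o i j = solve 13 (λ a₁ a₂ b₁ b₂ o₁ o₂ u₁ u₂ v₁ v₂ s₁ s₂ c →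
      (a₁ :- b₁) :* (((u₁ :- s₁) :+ c :* (:- (a₂ :- o₂))) :- ((v₁ :- s₁) :+ c :* (:- (b₂ :- o₂))))
      :+ (a₂ :- b₂) :* (((u₂ :- s₂) :+ c :* (a₁ :- o₁)) :- ((v₂ :- s₂) :+ c :* (b₁ :- o₁)))
      := (a₁ :- b₁) :* (u₁ :- v₁) :+ (a₂ :- b₂) :* (u₂ :- v₂))
    refl (proj₁ (p i)) (proj₂ (p i)) (proj₁ (p j)) (proj₂ (p j)) (proj₁ o) (proj₂ o)
         (proj₁ (u i)) (proj₂ (u i)) (proj₁ (u j)) (proj₂ (u j)) (proj₁ s) (proj₂ s) c

  rigidityMap-pinned : ∀ p c {x y} → c y ≡ O → rigidityMap p c x y ≡ ⟨ p x ⊖ p y , c x ⟩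
  rigidityMap-pinned p c {x} {y} cy≡O = begin
    ⟨ p x ⊖ p y , c x ⊖ c y ⟩              ≡⟨ ⟨,⊖⟩ (p x ⊖ p y) (c x) (c y) ⟩
    ⟨ p x ⊖ p y , c x ⟩ - ⟨ p x ⊖ p y , c y ⟩ ≡⟨ cong (λ z → ⟨ p x ⊖ p y , c x ⟩ - ⟨ p x ⊖ p y , z ⟩) cy≡O ⟩
    ⟨ p x ⊖ p y , c x ⟩ - ⟨ p x ⊖ p y , O ⟩  ≡⟨ cong (λ z → ⟨ p x ⊖ p y , c x ⟩ - z) (⟨,O⟩ (p x ⊖ p y)) ⟩
    ⟨ p x ⊖ p y , c x ⟩ - 0ℝ               ≡⟨ solve 1 (λ z → z :- con 0ℤ := z) refl _ ⟩
    ⟨ p x ⊖ p y , c x ⟩                    ∎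

  ⊖-normalized : ∀ {q q' a b} → Normalized q q' a → Normalized q q' b → Normalized q q' (λ x → a x ⊖ b x)
  ⊖-normalized (aq≡O , a₁q'≡0) (bq≡O , b₁q'≡0) =
    trans (cong₂ _⊖_ aq≡O bq≡O) (cong₂ _,_ (-‿inverseʳ 0ℝ) (-‿inverseʳ 0ℝ)) ,
    trans (cong₂ _-_ a₁q'≡0 b₁q'≡0) (-‿inverseʳ 0ℝ)

  -- Subtract u q and add the infinitesimal rotation about p q whose speed c cancels the first
  -- coordinate at q', which is possible because p q and p q' have different heights.
  normalize : ∀ p {q q'} → proj₂ (p q) ≢ proj₂ (p q') → (u : Motion) →
    Σ Motion λ v → Normalized q q' v × (∀ i j → rigidityMap p v i j ≡ rigidityMap p u i j)
  normalize p {q} {q'} yq≢yq' u = v , (vq≡O , v₁q'≡0) , rigidityMap-+-rigid p u (u q) c (p q)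
    where
    Δx Δy c : ℝ
    Δx = proj₁ (u q') - proj₁ (u q)
    Δy = proj₂ (p q') - proj₂ (p q)
    c = Δx * Δy ⁻¹
    v : Motion
    v x = (u x ⊖ u q) ⊕ (c · perp (p x ⊖ p q))
    vq≡O : v q ≡ O
    vq≡O = cong₂ _,_
      (solve 3 (λ a y c → (a :- a) :+ c :* (:- (y :- y)) := con 0ℤ) refl (proj₁ (u q)) (proj₂ (p q)) c)
      (solve 3 (λ a x c → (a :- a) :+ c :* (x :- x) := con 0ℤ) refl (proj₂ (u q)) (proj₁ (p q)) c)
    v₁q'≡0 : proj₁ (v q') ≡ 0ℝ
    v₁q'≡0 = begin
      Δx + c * (- Δy)          ≡⟨ solve 3 (λ Δx Δy Δy⁻¹ → Δx :+ (Δx :* Δy⁻¹) :* (:- Δy) := Δx :* (con 1ℤ :- Δy :* Δy⁻¹))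
                                    refl Δx Δy (Δy ⁻¹) ⟩
      Δx * (1ℝ - Δy * Δy ⁻¹)   ≡⟨ cong (λ z → Δx * (1ℝ - z)) (*-inverse Δy (λ Δy≡0 → yq≢yq' (sym (x-y≡0⇒x≡y Δy≡0)))) ⟩
      Δx * (1ℝ - 1ℝ)           ≡⟨ solve 1 (λ Δx → Δx :* (con 1ℤ :- con 1ℤ) := con 0ℤ) refl Δx ⟩
      0ℝ                       ∎

  sumOver : {A : Set} → List A → (A → ℝ) → ℝ
  sumOver xs g = foldr (λ x acc → g x + acc) 0ℝ xs

  module _ {A : Set} where

    sumOver-cong : ∀ {xs : List A} {g h} → (∀ {x} → x ∈ xs → g x ≡ h x) → sumOver xs g ≡ sumOver xs h
    sumOver-cong {[]} g≗h = refl
    sumOver-cong {x ∷ xs} g≗h = cong₂ _+_ (g≗h (here refl)) (sumOver-cong (λ x∈xs → g≗h (there x∈xs)))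

    sumOver-zero : ∀ {xs : List A} {g} → (∀ {x} → x ∈ xs → g x ≡ 0ℝ) → sumOver xs g ≡ 0ℝ
    sumOver-zero {[]} g≗0 = refl
    sumOver-zero {x ∷ xs} g≗0 =
      trans (cong₂ _+_ (g≗0 (here refl)) (sumOver-zero (λ x∈xs → g≗0 (there x∈xs)))) (+-identityˡ 0ℝ)

    *-distribˡ-sumOver : ∀ c (xs : List A) g → c * sumOver xs g ≡ sumOver xs (λ x → c * g x)
    *-distribˡ-sumOver c [] g = zeroʳ c
    *-distribˡ-sumOver c (x ∷ xs) g = begin
      c * (g x + sumOver xs g)        ≡⟨ solve 3 (λ c a b → c :* (a :+ b) := c :* a :+ c :* b) refl c (g x) _ ⟩
      c * g x + c * sumOver xs g      ≡⟨ cong ((c * g x) +_) (*-distribˡ-sumOver c xs g) ⟩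
      sumOver (x ∷ xs) (λ x → c * g x) ∎

    sumOver-− : ∀ (xs : List A) g h → sumOver xs (λ x → g x - h x) ≡ sumOver xs g - sumOver xs h
    sumOver-− [] g h = solve 0 (con 0ℤ := con 0ℤ :- con 0ℤ) refl
    sumOver-− (x ∷ xs) g h = begin
      (g x - h x) + sumOver xs (λ x → g x - h x)    ≡⟨ cong ((g x - h x) +_) (sumOver-− xs g h) ⟩
      (g x - h x) + (sumOver xs g - sumOver xs h)   ≡⟨ solve 4 (λ a b c d → (a :- b) :+ (c :- d) := (a :+ c) :- (b :+ d))
                                                        refl (g x) (h x) (sumOver xs g) (sumOver xs h) ⟩
      sumOver (x ∷ xs) g - sumOver (x ∷ xs) h       ∎

    sumOver-single : ∀ {xs : List A} {y g} → Unique xs → y ∈ xs → (∀ {x} → x ∈ xs → x ≢ y → g x ≡ 0ℝ) →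
      sumOver xs g ≡ g y
    sumOver-single {g = g} (y∉xs ∷ _) (here refl) vanish = trans
      (cong (g _ +_) (sumOver-zero (λ x∈xs → vanish (there x∈xs) (≢-sym (All.lookup y∉xs x∈xs)))))
      (+-identityʳ _)
    sumOver-single {y = y} {g} (x∉xs ∷ xs-unique) (there y∈xs) vanish = trans
      (cong₂ _+_ (vanish (here refl) (All.lookup x∉xs y∈xs)) (sumOver-single xs-unique y∈xs (λ x∈xs → vanish (there x∈xs))))
      (+-identityˡ (g y))

    sumOver-+ : ∀ (xs : List A) g h → sumOver xs (λ x → g x + h x) ≡ sumOver xs g + sumOver xs h
    sumOver-+ [] g h = sym (+-identityˡ 0ℝ)
    sumOver-+ (x ∷ xs) g h = begin
      (g x + h x) + sumOver xs (λ x → g x + h x)    ≡⟨ cong ((g x + h x) +_) (sumOver-+ xs g h) ⟩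
      (g x + h x) + (sumOver xs g + sumOver xs h)   ≡⟨ solve 4 (λ a b c d → (a :+ b) :+ (c :+ d) := (a :+ c) :+ (b :+ d))
                                                        refl (g x) (h x) (sumOver xs g) (sumOver xs h) ⟩
      sumOver (x ∷ xs) g + sumOver (x ∷ xs) h       ∎

  -- R p f unfolds definitionally to sumOverPairs (λ i j → w p i j * f i j).
  sumOverPairs : (Fin 4 → Fin 4 → ℝ) → ℝ
  sumOverPairs g = sumOver pairs (λ e → g (proj₁ e) (proj₂ e))

  sumOverPoints : (Fin 4 → ℝ) → ℝ
  sumOverPoints = sumOver (allFin 4)

  <⇒∈pairs : ∀ {i j} → i <ᶠ j → (i , j) ∈ pairs
  <⇒∈pairs {0F} {1F} _ = e₀₁
  <⇒∈pairs {0F} {2F} _ = e₀₂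
  <⇒∈pairs {0F} {3F} _ = e₀₃
  <⇒∈pairs {1F} {2F} _ = e₁₂
  <⇒∈pairs {1F} {3F} _ = e₁₃
  <⇒∈pairs {2F} {3F} _ = e₂₃
  <⇒∈pairs {_} {0F} ()
  <⇒∈pairs {suc _} {1F} (ℕ.s≤s ())
  <⇒∈pairs {suc (suc _)} {2F} (ℕ.s≤s (ℕ.s≤s ()))
  <⇒∈pairs {3F} {3F} (ℕ.s≤s (ℕ.s≤s (ℕ.s≤s ())))

  ∈pairs⇒< : ∀ {i j} → (i , j) ∈ pairs → i <ᶠ j
  ∈pairs⇒< e₀₁ = ℕ.z<s
  ∈pairs⇒< e₀₂ = ℕ.z<s
  ∈pairs⇒< e₀₃ = ℕ.z<s
  ∈pairs⇒< e₁₂ = ℕ.s<s ℕ.z<s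
  ∈pairs⇒< e₁₃ = ℕ.s<s ℕ.z<s
  ∈pairs⇒< e₂₃ = ℕ.s<s (ℕ.s<s ℕ.z<s)

  pairs-unique : Unique pairs
  pairs-unique = from-yes (unique? (≡-dec Fin._≟_ Fin._≟_) pairs)

  R-− : ∀ p f g → R p f - R p g ≡ R p (λ i j → f i j - g i j)
  R-− p f g = begin
    R p f - R p g
      ≡⟨ sumOver-− pairs (weighted f) (weighted g) ⟨
    sumOverPairs (λ i j → w p i j * f i j - w p i j * g i j)
      ≡⟨ sumOver-cong {xs = pairs} (λ {e} _ → let (i , j) = e in
           solve 3 (λ c a b → c :* a :- c :* b := c :* (a :- b)) refl (w p i j) (f i j) (g i j)) ⟩
    R p (λ i j → f i j - g i j) ∎
    where
    weighted : EdgeFn → Fin 4 × Fin 4 → ℝ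
    weighted h (i , j) = w p i j * h i j

  R-supported : ∀ p {k l} → k <ᶠ l → (h : EdgeFn) → (∀ i j → i <ᶠ j → ¬ ((i ≡ k) × (j ≡ l)) → h i j ≡ 0ℝ) →
    R p h ≡ w p k l * h k l
  R-supported p k<l h vanish = sumOver-single pairs-unique (<⇒∈pairs k<l) λ {(i , j)} ij∈pairs ij≢kl →
    trans (cong (w p i j *_) (vanish i j (∈pairs⇒< ij∈pairs) λ { (refl , refl) → ij≢kl refl })) (zeroʳ _)

  -- The self-stress of K₄

  -- Counterparts on solver polynomials that unfold like the sums above, so that identities
  -- between sums can be handed to the solver.
  :sumOver : ∀ {n} {A : Set} → List A → (A → Polynomial n) → Polynomial n
  :sumOver xs g = foldr (λ x acc → g x :+ acc) (con 0ℤ) xs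

  :sumOverPairs : ∀ {n} → (Fin 4 → Fin 4 → Polynomial n) → Polynomial n
  :sumOverPairs g = :sumOver pairs (λ e → g (proj₁ e) (proj₂ e))

  :sumOverPoints : ∀ {n} → (Fin 4 → Polynomial n) → Polynomial n
  :sumOverPoints = :sumOver (allFin 4)

  vec₄ : {A : Set} → A → A → A → A → Fin 4 → A
  vec₄ a b c d 0F = a
  vec₄ a b c d 1F = b
  vec₄ a b c d 2F = c
  vec₄ a b c d 3F = d

  pairwise-expansion : ∀ (ω a b : Fin 4 → ℝ) →
    sumOverPairs (λ i j → (ω i * ω j) * ((a i - a j) * (b i - b j)))
      ≡ sumOverPoints ω * sumOverPoints (λ i → ω i * (a i * b i))
        - sumOverPoints (λ i → ω i * a i) * sumOverPoints (λ i → ω i * b i)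
  pairwise-expansion ω a b = solve 12 (λ ω₀ ω₁ ω₂ ω₃ a₀ a₁ a₂ a₃ b₀ b₁ b₂ b₃ →
      expansion (vec₄ ω₀ ω₁ ω₂ ω₃) (vec₄ a₀ a₁ a₂ a₃) (vec₄ b₀ b₁ b₂ b₃))
    refl (ω 0F) (ω 1F) (ω 2F) (ω 3F) (a 0F) (a 1F) (a 2F) (a 3F) (b 0F) (b 1F) (b 2F) (b 3F)
    where
    expansion : ∀ {n} (Ω A B : Fin 4 → Polynomial n) → Polynomial n × Polynomial n
    expansion Ω A B =
      :sumOverPairs (λ i j → (Ω i :* Ω j) :* ((A i :- A j) :* (B i :- B j)))
      := :sumOverPoints Ω :* :sumOverPoints (λ i → Ω i :* (A i :* B i))
         :- :sumOverPoints (λ i → Ω i :* A i) :* :sumOverPoints (λ i → Ω i :* B i)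

  affine-dependence⇒self-stress : ∀ p (ω : Fin 4 → ℝ) → sumOverPoints ω ≡ 0ℝ →
    sumOverPoints (λ i → ω i * proj₁ (p i)) ≡ 0ℝ → sumOverPoints (λ i → ω i * proj₂ (p i)) ≡ 0ℝ →
    ∀ v → sumOverPairs (λ i j → (ω i * ω j) * rigidityMap p v i j) ≡ 0ℝ
  affine-dependence⇒self-stress p ω Σω≡0 Σωx≡0 Σωy≡0 v = begin
    sumOverPairs (λ i j → (ω i * ω j) * rigidityMap p v i j)
      ≡⟨ sumOver-cong {xs = pairs} (λ {e} _ → let (i , j) = e in
           solve 3 (λ c s t → c :* (s :+ t) := c :* s :+ c :* t) refl (ω i * ω j) (term x u i j) (term y t i j)) ⟩
    sumOver pairs (λ e → stressed x u e + stressed y t e)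
      ≡⟨ sumOver-+ pairs (stressed x u) (stressed y t) ⟩
    sumOver pairs (stressed x u) + sumOver pairs (stressed y t)
      ≡⟨ cong₂ _+_ (balanced x u Σωx≡0) (balanced y t Σωy≡0) ⟩
    0ℝ + 0ℝ
      ≡⟨ +-identityˡ 0ℝ ⟩
    0ℝ ∎
    where
    x y u t : Fin 4 → ℝ
    x i = proj₁ (p i)
    y i = proj₂ (p i)
    u i = proj₁ (v i)
    t i = proj₂ (v i)
    term : (Fin 4 → ℝ) → (Fin 4 → ℝ) → Fin 4 → Fin 4 → ℝ
    term a b i j = (a i - a j) * (b i - b j)
    stressed : (Fin 4 → ℝ) → (Fin 4 → ℝ) → Fin 4 × Fin 4 → ℝ
    stressed a b (i , j) = (ω i * ω j) * term a b i j
    balanced : ∀ a b → sumOverPoints (λ i → ω i * a i) ≡ 0ℝ → sumOver pairs (stressed a b) ≡ 0ℝ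
    balanced a b Σωa≡0 = begin
      sumOver pairs (stressed a b)                                  ≡⟨ pairwise-expansion ω a b ⟩
      sumOverPoints ω * Σωab - sumOverPoints (λ i → ω i * a i) * Σωb ≡⟨ cong₂ (λ s r → s * Σωab - r * Σωb) Σω≡0 Σωa≡0 ⟩
      0ℝ * Σωab - 0ℝ * Σωb                                          ≡⟨ solve 2 (λ c d → con 0ℤ :* c :- con 0ℤ :* d := con 0ℤ)
                                                                         refl Σωab Σωb ⟩
      0ℝ                                                            ∎
      where
      Σωab Σωb : ℝ
      Σωab = sumOverPoints (λ i → ω i * (a i * b i))
      Σωb = sumOverPoints (λ i → ω i * b i)

  -- Parametrised by the determinant, so that it can be read both over ℝ and on solver polynomials.
  affineDependence : {A B : Set} → (A → A → A → B) → (B → B) → (Fin 4 → A) → Fin 4 → B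
  affineDependence D neg q 0F = D (q 1F) (q 2F) (q 3F)
  affineDependence D neg q 1F = neg (D (q 0F) (q 2F) (q 3F))
  affineDependence D neg q 2F = D (q 0F) (q 1F) (q 3F)
  affineDependence D neg q 3F = neg (D (q 0F) (q 1F) (q 2F))

  :det : ∀ {n} → Polynomial n × Polynomial n → Polynomial n × Polynomial n → Polynomial n × Polynomial n → Polynomial n
  :det (a₁ , a₂) (b₁ , b₂) (c₁ , c₂) = a₁ :* (b₂ :- c₂) :- b₁ :* (a₂ :- c₂) :+ c₁ :* (a₂ :- b₂)

  -- Motions tight on all edges but one

  TightExcept : Config → EdgeFn → Motion → Fin 4 → Fin 4 → Set
  TightExcept p f v k l = ∀ i j → i <ᶠ j → ¬ ((i ≡ k) × (j ≡ l)) → Tight p f v i j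

  tightExcept-from-pairs : ∀ {p f u k l} → (∀ {i j} → (i , j) ∈ pairs → ¬ ((i ≡ k) × (j ≡ l)) → Tight p f u i j) → TightExcept p f u k l
  tightExcept-from-pairs tight i j i<j = tight (<⇒∈pairs i<j)

  slack⇒edgeSet≡G : ∀ {p f v k l} → TightExcept p f v k l → f k l < rigidityMap p v k l →
    ∀ i j → i <ᶠ j → Tight p f v i j ⇔ (¬ ((i ≡ k) × (j ≡ l)))
  slack⇒edgeSet≡G {f = f} {k = k} {l} tight slack i j i<j =
    mk⇔ (λ { t (refl , refl) → <-irrefl (subst (f k l <_) t slack) }) (tight i j i<j)

  edgeSet≡G⇒slack : ∀ {p f q q' v k l} → k <ᶠ l → InX p f q q' v →
    (∀ i j → i <ᶠ j → Tight p f v i j ⇔ (¬ ((i ≡ k) × (j ≡ l)))) → TightExcept p f v k l × f k l < rigidityMap p v k l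
  edgeSet≡G⇒slack k<l (_ , feasible) edgeSet =
    (λ i j i<j → Equivalence.from (edgeSet i j i<j)) ,
    ≤∧≢⇒< (feasible _ _ k<l) (λ f≡E → Equivalence.to (edgeSet _ _ k<l) (sym f≡E) (refl , refl))

  record K₄MinusEdgeMotion (a b c d : Point) (fab fac fbc fad fbd : ℝ) : Set where
    field
      ub uc ud : Point
      ba : ⟨ b ⊖ a , ub ⊖ O ⟩ ≡ fab
      ca : ⟨ c ⊖ a , uc ⊖ O ⟩ ≡ fac
      cb : ⟨ c ⊖ b , uc ⊖ ub ⟩ ≡ fbc
      da : ⟨ d ⊖ a , ud ⊖ O ⟩ ≡ fad
      db : ⟨ d ⊖ b , ud ⊖ ub ⟩ ≡ fbd

  -- a is pinned, b is placed by the edge ab, and c and d are each attached to a and b.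
  k₄MinusEdgeMotion : ∀ {a b c d} → det b a c ≢ 0ℝ → det c a b ≢ 0ℝ → det d a b ≢ 0ℝ →
    ∀ fab fac fbc fad fbd → K₄MinusEdgeMotion a b c d fab fac fbc fad fbd
  k₄MinusEdgeMotion {a} {b} {c} {d} bac≢0 cab≢0 dab≢0 fab fac fbc fad fbd = record
    { ub = ub ; uc = proj₁ C ; ud = proj₁ D
    ; ba = proj₁ (proj₂ B) ; ca = proj₁ (proj₂ C) ; cb = proj₂ (proj₂ C) ; da = proj₁ (proj₂ D) ; db = proj₂ (proj₂ D)
    }
    where
    B : Σ Point λ ub → ⟨ b ⊖ a , ub ⊖ O ⟩ ≡ fab × ⟨ b ⊖ c , ub ⊖ O ⟩ ≡ 0ℝ
    B = attach bac≢0 O O fab 0ℝ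
    ub : Point
    ub = proj₁ B
    C : Σ Point λ uc → ⟨ c ⊖ a , uc ⊖ O ⟩ ≡ fac × ⟨ c ⊖ b , uc ⊖ ub ⟩ ≡ fbc
    C = attach cab≢0 O ub fac fbc
    D : Σ Point λ ud → ⟨ d ⊖ a , ud ⊖ O ⟩ ≡ fad × ⟨ d ⊖ b , ud ⊖ ub ⟩ ≡ fbd
    D = attach dab≢0 O ub fad fbd

  module _ (p : Config) (gp : GeneralPosition p) where

    ω : Fin 4 → ℝ
    ω = affineDependence det -_ p

    private
      coordinates : Vec ℝ 8
      coordinates = proj₁ (p 0F) ∷ᵥ proj₂ (p 0F) ∷ᵥ proj₁ (p 1F) ∷ᵥ proj₂ (p 1F)
                 ∷ᵥ proj₁ (p 2F) ∷ᵥ proj₂ (p 2F) ∷ᵥ proj₁ (p 3F) ∷ᵥ proj₂ (p 3F) ∷ᵥ []ᵥ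

      P : Fin 4 → Polynomial 8 × Polynomial 8
      P 0F = var (# 0) , var (# 1)
      P 1F = var (# 2) , var (# 3)
      P 2F = var (# 4) , var (# 5)
      P 3F = var (# 6) , var (# 7)

      Ω : Fin 4 → Polynomial 8
      Ω = affineDependence :det :-_ P

      :stressScale : Polynomial 8
      :stressScale = :- (Ω 0F :* Ω 1F :* Ω 2F :* Ω 3F)

      :denominator*ω*ω : Fin 4 → Fin 4 → Polynomial 8
      :denominator*ω*ω i j =
        (:det (P i) (P j) (P (proj₁ (complement i j))) :* :det (P i) (P j) (P (proj₂ (complement i j)))) :* (Ω i :* Ω j)

    ω-sum : sumOverPoints ω ≡ 0ℝ
    ω-sum = prove coordinates (:sumOverPoints Ω) (con 0ℤ) refl

    ω-moment₁ : sumOverPoints (λ i → ω i * proj₁ (p i)) ≡ 0ℝ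
    ω-moment₁ = prove coordinates (:sumOverPoints (λ i → Ω i :* proj₁ (P i))) (con 0ℤ) refl

    ω-moment₂ : sumOverPoints (λ i → ω i * proj₂ (p i)) ≡ 0ℝ
    ω-moment₂ = prove coordinates (:sumOverPoints (λ i → Ω i :* proj₂ (P i))) (con 0ℤ) refl

    stressScale : ℝ
    stressScale = - (ω 0F * ω 1F * ω 2F * ω 3F)

    -- One clause per pair, because normalization needs i and j to be concrete.
    stressScale-factorization : ∀ {i j} → (i , j) ∈ pairs →
      stressScale ≡ (det (p i) (p j) (p (proj₁ (complement i j))) * det (p i) (p j) (p (proj₂ (complement i j)))) * (ω i * ω j)
    stressScale-factorization {i} {j} e₀₁ = prove coordinates :stressScale (:denominator*ω*ω i j) refl
    stressScale-factorization {i} {j} e₀₂ = prove coordinates :stressScale (:denominator*ω*ω i j) refl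
    stressScale-factorization {i} {j} e₀₃ = prove coordinates :stressScale (:denominator*ω*ω i j) refl
    stressScale-factorization {i} {j} e₁₂ = prove coordinates :stressScale (:denominator*ω*ω i j) refl
    stressScale-factorization {i} {j} e₁₃ = prove coordinates :stressScale (:denominator*ω*ω i j) refl
    stressScale-factorization {i} {j} e₂₃ = prove coordinates :stressScale (:denominator*ω*ω i j) refl

    ω≢0 : ∀ i → ω i ≢ 0ℝ
    ω≢0 0F = gp 1F 2F 3F (λ ()) (λ ()) (λ ())
    ω≢0 1F = -x≢0 (gp 0F 2F 3F (λ ()) (λ ()) (λ ()))
    ω≢0 2F = gp 0F 1F 3F (λ ()) (λ ()) (λ ())
    ω≢0 3F = -x≢0 (gp 0F 1F 2F (λ ()) (λ ()) (λ ()))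

    stressScale≢0 : stressScale ≢ 0ℝ
    stressScale≢0 = -x≢0 (x*y≢0 (x*y≢0 (x*y≢0 (ω≢0 0F) (ω≢0 1F)) (ω≢0 2F)) (ω≢0 3F))

    stressScale*w≡ω*ω : ∀ {i j} → (i , j) ∈ pairs → stressScale * w p i j ≡ ω i * ω j
    stressScale*w≡ω*ω ij∈pairs = x≡d*m⇒x*d⁻¹≡m stressScale≢0 (stressScale-factorization ij∈pairs)

    w≢0 : ∀ {i j} → i <ᶠ j → w p i j ≢ 0ℝ
    w≢0 {i} {j} i<j w≡0 = x*y≢0 (ω≢0 i) (ω≢0 j) (begin
      ω i * ω j              ≡⟨ stressScale*w≡ω*ω (<⇒∈pairs i<j) ⟨
      stressScale * w p i j  ≡⟨ cong (stressScale *_) w≡0 ⟩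
      stressScale * 0ℝ       ≡⟨ zeroʳ stressScale ⟩
      0ℝ                     ∎)

    R-rigidityMap≡0 : ∀ v → R p (rigidityMap p v) ≡ 0ℝ
    R-rigidityMap≡0 v = x*y≡0⇒y≡0 stressScale≢0 (begin
      stressScale * R p (rigidityMap p v)
        ≡⟨ *-distribˡ-sumOver stressScale pairs (λ e → w p (proj₁ e) (proj₂ e) * rigidityMap p v (proj₁ e) (proj₂ e)) ⟩
      sumOverPairs (λ i j → stressScale * (w p i j * rigidityMap p v i j))
        ≡⟨ sumOver-cong {xs = pairs} (λ {e} ij∈pairs → let (i , j) = e in
             trans (sym (*-assoc stressScale (w p i j) (rigidityMap p v i j)))
                   (cong (_* rigidityMap p v i j) (stressScale*w≡ω*ω ij∈pairs))) ⟩
      sumOverPairs (λ i j → (ω i * ω j) * rigidityMap p v i j)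
        ≡⟨ affine-dependence⇒self-stress p ω ω-sum ω-moment₁ ω-moment₂ v ⟩
      0ℝ ∎)

    R≡w*slack : ∀ {f v k l} → k <ᶠ l → TightExcept p f v k l → R p f ≡ w p k l * (f k l - rigidityMap p v k l)
    R≡w*slack {f} {v} {k} {l} k<l tight = begin
      R p f                                      ≡⟨ solve 1 (λ r → r := r :- con 0ℤ) refl (R p f) ⟩
      R p f - 0ℝ                                 ≡⟨ cong (λ z → R p f - z) (R-rigidityMap≡0 v) ⟨
      R p f - R p (rigidityMap p v)              ≡⟨ R-− p f (rigidityMap p v) ⟩
      R p (λ i j → f i j - rigidityMap p v i j)  ≡⟨ R-supported p k<l _ (λ i j i<j ¬kl → x≡y⇒x-y≡0 (sym (tight i j i<j ¬kl))) ⟩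
      w p k l * (f k l - rigidityMap p v k l)    ∎

    R*w<0⇔slack : ∀ {f v k l} → k <ᶠ l → TightExcept p f v k l → R p f * w p k l < 0ℝ ⇔ f k l < rigidityMap p v k l
    R*w<0⇔slack {f} {v} {k} {l} k<l tight =
      subst (λ r → r * w p k l < 0ℝ ⇔ f k l < rigidityMap p v k l) (sym (R≡w*slack k<l tight))
        (⇔-trans (x*y*x<0⇔y<0 (w≢0 k<l)) x-y<0⇔x<y)

    tightExcept-determines-rigidityMap : ∀ {f a b k l} → k <ᶠ l → TightExcept p f a k l → TightExcept p f b k l →
      ∀ i j → i <ᶠ j → rigidityMap p a i j ≡ rigidityMap p b i j
    tightExcept-determines-rigidityMap {f} {a} {b} {k} {l} k<l tight-a tight-b i j i<j
      with (i Fin.≟ k) ×-dec (j Fin.≟ l)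
    ... | yes (refl , refl) = begin
      rigidityMap p a k l                    ≡⟨ solve 2 (λ x y → y := x :- (x :- y)) refl (f k l) (rigidityMap p a k l) ⟩
      f k l - (f k l - rigidityMap p a k l)  ≡⟨ cong (λ z → f k l - z) (*-cancelˡ (w≢0 k<l)
                                                  (trans (sym (R≡w*slack k<l tight-a)) (R≡w*slack k<l tight-b))) ⟩
      f k l - (f k l - rigidityMap p b k l)  ≡⟨ solve 2 (λ x y → x :- (x :- y) := y) refl (f k l) (rigidityMap p b k l) ⟩
      rigidityMap p b k l                    ∎
    ... | no ¬kl = trans (tight-a i j i<j ¬kl) (sym (tight-b i j i<j ¬kl))

    -- c q' is orthogonal to p q' − p q and has first coordinate 0; any other c x is orthogonal
    -- to the independent vectors p x − p q and p x − p q'.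
    infinitesimally-rigid : ∀ {q q' c} → proj₂ (p q) ≢ proj₂ (p q') → Normalized q q' c →
      (∀ i j → i <ᶠ j → rigidityMap p c i j ≡ 0ℝ) → ∀ x → c x ≡ O
    infinitesimally-rigid {q} {q'} {c} yq≢yq' (cq≡O , c₁q'≡0) c-flex = c≡O
      where
      q≢q' : q ≢ q'
      q≢q' q≡q' = yq≢yq' (cong (λ i → proj₂ (p i)) q≡q')
      flex : ∀ {i j} → i ≢ j → rigidityMap p c i j ≡ 0ℝ
      flex {i} {j} i≢j with Fin.<-cmp i j
      ... | tri< i<j _ _ = c-flex i j i<j
      ... | tri≈ _ i≡j _ = ⊥-elim (i≢j i≡j)
      ... | tri> _ _ j<i = trans (rigidityMap-sym p c i j) (c-flex j i j<i)
      Δx Δy c₁ c₂ : ℝ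
      Δx = proj₁ (p q') - proj₁ (p q)
      Δy = proj₂ (p q') - proj₂ (p q)
      c₁ = proj₁ (c q')
      c₂ = proj₂ (c q')
      cq'≡O : c q' ≡ O
      cq'≡O = cong₂ _,_ c₁q'≡0 (x*y≡0⇒y≡0 (λ Δy≡0 → yq≢yq' (sym (x-y≡0⇒x≡y Δy≡0))) (begin
        Δy * c₂                      ≡⟨ solve 4 (λ Δx Δy c₁ c₂ → Δy :* c₂ := (Δx :* c₁ :+ Δy :* c₂) :- Δx :* c₁) refl Δx Δy c₁ c₂ ⟩
        ⟨ p q' ⊖ p q , c q' ⟩ - Δx * c₁ ≡⟨ cong₂ (λ s t → s - Δx * t)
                                           (trans (sym (rigidityMap-pinned p c cq≡O)) (flex (λ q'≡q → q≢q' (sym q'≡q)))) c₁q'≡0 ⟩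
        0ℝ - Δx * 0ℝ                 ≡⟨ solve 1 (λ Δx → con 0ℤ :- Δx :* con 0ℤ := con 0ℤ) refl Δx ⟩
        0ℝ                           ∎))
      c≡O : ∀ x → c x ≡ O
      c≡O x with x Fin.≟ q | x Fin.≟ q'
      ... | yes refl | _ = cq≡O
      ... | no _ | yes refl = cq'≡O
      ... | no x≢q | no x≢q' = ⟨⟩≡0⇒≡O
        (λ C≡0 → gp x q q' x≢q q≢q' x≢q' (trans (sym (cross-⊖≡det (p x) (p q) (p q'))) C≡0))
        (trans (sym (rigidityMap-pinned p c cq≡O)) (flex x≢q))
        (trans (sym (rigidityMap-pinned p c cq'≡O)) (flex x≢q'))

    -- For the missing edge kl with complementary pair ij, the points a b c d of K₄MinusEdgeMotion
    -- are p i, p j, p k, p l.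
    tightExcept-motion : ∀ {k l} → (k , l) ∈ pairs → (f : EdgeFn) → Σ Motion λ u → TightExcept p f u k l
    tightExcept-motion e₀₁ f = u , tightExcept-from-pairs λ where
        e₀₁ ¬kl → ⊥-elim (¬kl (refl , refl))
        e₀₂ _ → ca
        e₀₃ _ → cb
        e₁₂ _ → da
        e₁₃ _ → db
        e₂₃ _ → rigidityMap-flip p u ba
      where
      open K₄MinusEdgeMotion (k₄MinusEdgeMotion (gp 3F 2F 0F (λ ()) (λ ()) (λ ())) (gp 0F 2F 3F (λ ()) (λ ()) (λ ()))
        (gp 1F 2F 3F (λ ()) (λ ()) (λ ())) (f 2F 3F) (f 0F 2F) (f 0F 3F) (f 1F 2F) (f 1F 3F))
      u : Motion
      u = vec₄ uc ud O ub
    tightExcept-motion e₀₂ f = u , tightExcept-from-pairs λ where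
        e₀₁ _ → ca
        e₀₂ ¬kl → ⊥-elim (¬kl (refl , refl))
        e₀₃ _ → cb
        e₁₂ _ → rigidityMap-flip p u da
        e₁₃ _ → rigidityMap-flip p u ba
        e₂₃ _ → db
      where
      open K₄MinusEdgeMotion (k₄MinusEdgeMotion (gp 3F 1F 0F (λ ()) (λ ()) (λ ())) (gp 0F 1F 3F (λ ()) (λ ()) (λ ()))
        (gp 2F 1F 3F (λ ()) (λ ()) (λ ())) (f 1F 3F) (f 0F 1F) (f 0F 3F) (f 1F 2F) (f 2F 3F))
      u : Motion
      u = vec₄ uc O ud ub
    tightExcept-motion e₀₃ f = u , tightExcept-from-pairs λ where
        e₀₁ _ → ca
        e₀₂ _ → cb
        e₀₃ ¬kl → ⊥-elim (¬kl (refl , refl))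
        e₁₂ _ → rigidityMap-flip p u ba
        e₁₃ _ → rigidityMap-flip p u da
        e₂₃ _ → rigidityMap-flip p u db
      where
      open K₄MinusEdgeMotion (k₄MinusEdgeMotion (gp 2F 1F 0F (λ ()) (λ ()) (λ ())) (gp 0F 1F 2F (λ ()) (λ ()) (λ ()))
        (gp 3F 1F 2F (λ ()) (λ ()) (λ ())) (f 1F 2F) (f 0F 1F) (f 0F 2F) (f 1F 3F) (f 2F 3F))
      u : Motion
      u = vec₄ uc O ub ud
    tightExcept-motion e₁₂ f = u , tightExcept-from-pairs λ where
        e₀₁ _ → rigidityMap-flip p u ca
        e₀₂ _ → rigidityMap-flip p u da
        e₀₃ _ → rigidityMap-flip p u ba
        e₁₂ ¬kl → ⊥-elim (¬kl (refl , refl))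
        e₁₃ _ → cb
        e₂₃ _ → db
      where
      open K₄MinusEdgeMotion (k₄MinusEdgeMotion (gp 3F 0F 1F (λ ()) (λ ()) (λ ())) (gp 1F 0F 3F (λ ()) (λ ()) (λ ()))
        (gp 2F 0F 3F (λ ()) (λ ()) (λ ())) (f 0F 3F) (f 0F 1F) (f 1F 3F) (f 0F 2F) (f 2F 3F))
      u : Motion
      u = vec₄ O uc ud ub
    tightExcept-motion e₁₃ f = u , tightExcept-from-pairs λ where
        e₀₁ _ → rigidityMap-flip p u ca
        e₀₂ _ → rigidityMap-flip p u ba
        e₀₃ _ → rigidityMap-flip p u da
        e₁₂ _ → cb
        e₁₃ ¬kl → ⊥-elim (¬kl (refl , refl))
        e₂₃ _ → rigidityMap-flip p u db
      where
      open K₄MinusEdgeMotion (k₄MinusEdgeMotion (gp 2F 0F 1F (λ ()) (λ ()) (λ ())) (gp 1F 0F 2F (λ ()) (λ ()) (λ ()))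
        (gp 3F 0F 2F (λ ()) (λ ()) (λ ())) (f 0F 2F) (f 0F 1F) (f 1F 2F) (f 0F 3F) (f 2F 3F))
      u : Motion
      u = vec₄ O uc ub ud
    tightExcept-motion e₂₃ f = u , tightExcept-from-pairs λ where
        e₀₁ _ → rigidityMap-flip p u ba
        e₀₂ _ → rigidityMap-flip p u ca
        e₀₃ _ → rigidityMap-flip p u da
        e₁₂ _ → rigidityMap-flip p u cb
        e₁₃ _ → rigidityMap-flip p u db
        e₂₃ ¬kl → ⊥-elim (¬kl (refl , refl))
      where
      open K₄MinusEdgeMotion (k₄MinusEdgeMotion (gp 1F 0F 2F (λ ()) (λ ()) (λ ())) (gp 2F 0F 1F (λ ()) (λ ()) (λ ()))
        (gp 3F 0F 1F (λ ()) (λ ()) (λ ())) (f 0F 1F) (f 0F 2F) (f 1F 2F) (f 0F 3F) (f 1F 3F))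
      u : Motion
      u = vec₄ O ub uc ud

    normalized-tightExcept-motion : ∀ {q q' k l} → proj₂ (p q) ≢ proj₂ (p q') → k <ᶠ l → (f : EdgeFn) →
      Σ Motion λ v → Normalized q q' v × TightExcept p f v k l
    normalized-tightExcept-motion yq≢yq' k<l f =
      let (u , u-tight) = tightExcept-motion (<⇒∈pairs k<l) f
          (v , v-normalized , v≈u) = normalize p yq≢yq' u
      in v , v-normalized , λ i j i<j ¬kl → trans (v≈u i j) (u-tight i j i<j ¬kl)

    slack⇒isVertex : ∀ {f q q' k l v} → proj₂ (p q) ≢ proj₂ (p q') → k <ᶠ l → Normalized q q' v →
      TightExcept p f v k l → f k l < rigidityMap p v k l → IsVertex p f q q' v
    slack⇒isVertex {f} {q} {q'} {k} {l} {v} yq≢yq' k<l v-normalized tight slack = (v-normalized , feasible) , extreme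
      where
      feasible : ∀ i j → i <ᶠ j → f i j ≤ rigidityMap p v i j
      feasible i j i<j with (i Fin.≟ k) ×-dec (j Fin.≟ l)
      ... | yes (refl , refl) = inj₁ slack
      ... | no ¬kl = inj₂ (sym (tight i j i<j ¬kl))
      extreme : ∀ a b t → InX p f q q' a → InX p f q q' b → 0ℝ < t → t < 1ℝ →
        (∀ i → v i ≡ (t · a i) ⊕ ((1ℝ - t) · b i)) → ∀ i → a i ≡ b i
      extreme a b t (a-normalized , a-feasible) (b-normalized , b-feasible) 0<t t<1 v≡ta+sb x =
        ⊖≡O⇒≡ (infinitesimally-rigid yq≢yq' (⊖-normalized {a = a} {b} a-normalized b-normalized) a-b-flex x)
        where
        both-tight : ∀ i j → i <ᶠ j → ¬ ((i ≡ k) × (j ≡ l)) → Tight p f a i j × Tight p f b i j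
        both-tight i j i<j ¬kl = proper-convex-combination-of-≥⇒≡ 0<t t<1 (a-feasible i j i<j) (b-feasible i j i<j)
          (trans (sym (tight i j i<j ¬kl)) (rigidityMap-convex p t (1ℝ - t) v≡ta+sb i j))
        a-b-flex : ∀ i j → i <ᶠ j → rigidityMap p (λ x → a x ⊖ b x) i j ≡ 0ℝ
        a-b-flex i j i<j = trans (rigidityMap-⊖ p a b i j) (x≡y⇒x-y≡0 (tightExcept-determines-rigidityMap k<l
          (λ i j i<j ¬kl → proj₁ (both-tight i j i<j ¬kl)) (λ i j i<j ¬kl → proj₂ (both-tight i j i<j ¬kl)) i j i<j))

lemma3p8 : (F : RealField) → let open Geometry F in
    (p : Config) → GeneralPosition p → (f : EdgeFn) →
    (q q' : Fin 4) → proj₂ (p q) ≢ proj₂ (p q') →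
    (k l : Fin 4) → k <ᶠ l →
    (∃ λ v → IsVertex p f q q' v ×
       (∀ i j → i <ᶠ j → Tight p f v i j ⇔ (¬ ((i ≡ k) × (j ≡ l)))))
    ⇔ (R p f * w p k l < 0ℝ)
lemma3p8 F p gp f q q' yq≢yq' k l k<l = mk⇔ vertex⇒sign sign⇒vertex
  where
  open Geometry F
  open InfinitesimalMotions F
  vertex⇒sign : (∃ λ v → IsVertex p f q q' v × (∀ i j → i <ᶠ j → Tight p f v i j ⇔ (¬ ((i ≡ k) × (j ≡ l))))) →
    R p f * w p k l < 0ℝ
  vertex⇒sign (v , (v∈X , _) , edgeSet) =
    let (tight , slack) = edgeSet≡G⇒slack k<l v∈X edgeSet
    in Equivalence.from (R*w<0⇔slack p gp k<l tight) slack
  sign⇒vertex : R p f * w p k l < 0ℝ →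
    ∃ λ v → IsVertex p f q q' v × (∀ i j → i <ᶠ j → Tight p f v i j ⇔ (¬ ((i ≡ k) × (j ≡ l))))
  sign⇒vertex Rw<0 =
    let (v , v-normalized , tight) = normalized-tightExcept-motion p gp yq≢yq' k<l f
        slack = Equivalence.to (R*w<0⇔slack p gp k<l tight) Rw<0
    in v , slack⇒isVertex p gp yq≢yq' k<l v-normalized tight slack , slack⇒edgeSet≡G tight slack
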